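{- For every $k\ge 2$ there is $n_0$ such that the following holds for every $k$-graph $H=(V,E)$ on $n\ge n_0$ vertices with $\delta_1(H) \geq (1-\varepsilon)\binom{n-1}{k-1}$, where $\varepsilon = \frac{1}{22(1280k^3)^{k-1}}$. Let $(x_1,\ldots,x_{2k-2})$ be chosen uniformly at random from $V^{2k-2}$. Then the probability that all $x_i$ are pairwise distinct and both $(x_1, \ldots, x_{k-1})$ and $(x_{2k-2}, \ldots, x_k)$ are good is at least $\frac{8}{11}$.
   Context: $\delta_1(H)$ is the minimum vertex degree of $H$. For a set $\{x_1,\ldots,x_i\}$ of vertices, $\deg(x_1,\ldots,x_i)$ is the number of edges of $H$ containing it. Let $\rho = (22\varepsilon)^{1/(k-1)}$. A $(k-1)$-tuple $(x_1,\ldots,x_{k-1})$ of vertices is good if the $x_i$ are pairwise distinct and for all $i \in \{1,\ldots,k-1\}$, $\deg(x_1,\ldots,x_i) \geq (1-\rho^{k-i})\binom{n-i}{k-i}$. -}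

module Defs where

open import Data.Bool using (Bool; true; false; _∧_; not; T)
open import Data.Nat using (ℕ; zero; suc; _+_; _*_; _∸_; _^_; _≤_; _≤ᵇ_; _≡ᵇ_)
open import Data.Nat.Combinatorics using (_C_)
open import Data.Fin using (Fin; toℕ)
open import Data.Fin.Subset using (Subset; inside; outside; ∣_∣)
open import Data.Vec using (Vec; []; _∷_; lookup; toList)
open import Data.List using (List; []; _∷_; [_]; map; _++_; filterᵇ; length; concatMap; allFin; take; drop; reverse; upTo)
open import Data.Bool.ListAction using (all; any)
open import Relation.Binary.PropositionalEquality using (_≡_)

record KGraph (k n : ℕ) : Set where
  field
    edge    : Subset n → Bool
    uniform : ∀ (S : Subset n) → T (edge S) → ∣ S ∣ ≡ k
open KGraph public

allSubsets : (n : ℕ) → List (Subset n)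
allSubsets zero    = [ [] ]
allSubsets (suc n) = map (inside ∷_) (allSubsets n) ++ map (outside ∷_) (allSubsets n)

allTuples : (m n : ℕ) → List (Vec (Fin n) m)
allTuples zero    n = [ [] ]
allTuples (suc m) n = concatMap (λ v → map (_∷ v) (allFin n)) (allTuples m n)

deg : ∀ {k n} → KGraph k n → List (Fin n) → ℕ
deg {n = n} H xs = length (filterᵇ (λ S → edge H S ∧ all (lookup S) xs) (allSubsets n))

distinctᵇ : ∀ {n} → List (Fin n) → Bool
distinctᵇ []       = true
distinctᵇ (x ∷ xs) = not (any (λ y → toℕ x ≡ᵇ toℕ y) xs) ∧ distinctᵇ xs

-- D = 1280 k^3.  With ε = 1 / (22 D^(k-1)) we get 22ε = D^(-(k-1)),
-- hence ρ = (22ε)^(1/(k-1)) = 1/D exactly, and ρ^(k-i) = 1/D^(k-i).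
D : ℕ → ℕ
D k = 1280 * k ^ 3

-- a ≥ (1 - 1/q) b   ⇔   q * a ≥ (q - 1) * b   (for q ≥ 1), written in ℕ.
atLeastFrac : (q a b : ℕ) → Bool
atLeastFrac q a b = ((q ∸ 1) * b) ≤ᵇ (q * a)

MinDegCond : ∀ {k n} → KGraph k n → Set
MinDegCond {k} {n} H =
  ∀ (v : Fin n) → (22 * D k ^ (k ∸ 1) ∸ 1) * ((n ∸ 1) C (k ∸ 1)) ≤ 22 * D k ^ (k ∸ 1) * deg H [ v ]

good : ∀ {k n} → KGraph k n → List (Fin n) → Bool
good {k} {n} H xs =
  distinctᵇ xs ∧
  all (λ j → let i = suc j in
         atLeastFrac (D k ^ (k ∸ i)) (deg H (take i xs)) ((n ∸ i) C (k ∸ i)))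
      (upTo (k ∸ 1))

event : ∀ {k n} → KGraph k n → Vec (Fin n) (2 * k ∸ 2) → Bool
event {k} H x =
  distinctᵇ xs ∧ good H (take (k ∸ 1) xs) ∧ good H (reverse (drop (k ∸ 1) xs))
  where xs = toList x

eventCount : ∀ {k n} → KGraph k n → ℕ
eventCount {k} {n} H = length (filterᵇ (event H) (allTuples (2 * k ∸ 2) n))

module Submission where

-- Write N for the number of non-edges (k-sets that are not edges) and D = 1280 k³, so that
-- ρ = 1/D.  Double counting pairs (i-tuple, non-edge containing it) gives Σ nonDeg = k^i N over
-- all i-tuples, and the minimum degree condition says nonDeg(v) ≤ C(n-1,k-1)/(22 D^(k-1)) for
-- every vertex, hence 22 D^(k-1) k N ≤ n C(n-1,k-1).  A distinct i-tuple violating its degree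
-- condition lies in at least C(n-i,k-i)/D^(k-i) non-edges, so, as C(n-1,k-1) ≤ n^(i-1) C(n-i,k-i),
-- there are at most k^(i-1) n^i / (22 D^(i-1)) such tuples: at most n/22 for i = 1 and at most
-- n^i/(22k) for i ≥ 2, because k^i ≤ D^(i-1) then.  Summing over the prefixes of both halves,
-- at most 2/11 of all (2k-2)-tuples have a bad prefix, and at most (2k-2)²/n ≤ 1/11 of them
-- repeat an entry once n ≥ 44k².

open import Data.Bool using (Bool; true; false; _∧_; _∨_; not; T)
open import Data.Bool.ListAction using (all; any)
open import Data.Bool.Properties using (∧-zeroʳ; ∧-zeroˡ; ∧-assoc; ∧-comm; ∧-idem)
open import Data.Empty using (⊥-elim)
open import Data.Fin using (Fin; zero; suc; toℕ)
open import Data.Fin.Properties using (toℕ-injective)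
open import Data.Fin.Subset using (Subset; inside; outside; ∣_∣; ⊥)
open import Data.Fin.Subset.Properties using (∣p∣≤n; ∣⊥∣≡0)
open import Data.List
  using (List; []; _∷_; [_]; map; _++_; concatMap; length; allFin; filterᵇ; take; drop; reverse; upTo; applyUpTo)
open import Data.List.Membership.Propositional using (_∈_)
open import Data.List.Membership.Propositional.Properties using (∈-upTo⁻; ∈-applyUpTo⁻)
open import Data.List.Properties
  using ( map-tabulate; length-tabulate; length-applyUpTo; length-reverse; length-drop
        ; unfold-reverse; reverse-++; take++drop≡id; take-take )
open import Data.List.Relation.Binary.Permutation.Propositional using (↭-sym; ↭⇒↭ₛ)
open import Data.List.Relation.Binary.Permutation.Propositional.Properties using (↭-reverse)
import Data.List.Relation.Binary.Permutation.Setoid.Properties as Permutation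
open import Data.List.Relation.Unary.All using (All; []; _∷_)
open import Data.List.Relation.Unary.AllPairs using ([]; _∷_)
open import Data.List.Relation.Unary.Any using (here; there)
open import Data.List.Relation.Unary.Unique.Propositional using (Unique)
import Data.List.Relation.Unary.Unique.Propositional.Properties as Unique
open import Data.Nat
open import Data.Nat.Combinatorics using (_C_; nCk+nC[k+1]≡[n+1]C[k+1]; nC1≡n)
open import Data.Nat.Properties
open import Algebra.Properties.CommutativeSemigroup +-commutativeSemigroup
  using () renaming (interchange to +-interchange)
open import Algebra.Properties.CommutativeSemigroup *-commutativeSemigroup using (x∙yz≈y∙xz)
open import Data.Nat.Tactic.RingSolver using (solve-∀)
open import Data.Product using (_,_; ∃-syntax)
open import Data.Unit using (tt)
open import Data.Vec using (Vec; []; _∷_; toList; lookup; _[_]≔_)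
open import Data.Vec.Properties using (lookup-replicate; lookup∘update′)
open import Function using (_∘_; id; _⇔_; mk⇔; Equivalence)
open import Relation.Binary.PropositionalEquality hiding ([_])
open import Relation.Nullary using (¬_; yes; no)

open import Defs

-- Finite sums

𝟙 : Bool → ℕ
𝟙 true  = 1
𝟙 false = 0

∑ : {A : Set} → (A → ℕ) → List A → ℕ
∑ f []       = 0
∑ f (x ∷ xs) = f x + ∑ f xs

syntax ∑ (λ x → e) xs = ∑[ x ∈ xs ] e

𝟙-∧ : ∀ a b → 𝟙 (a ∧ b) ≡ 𝟙 a * 𝟙 b
𝟙-∧ true  b = sym (+-identityʳ (𝟙 b))
𝟙-∧ false b = refl

𝟙-∨-≤ : ∀ a b → 𝟙 (a ∨ b) ≤ 𝟙 a + 𝟙 b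
𝟙-∨-≤ true  b = s≤s z≤n
𝟙-∨-≤ false b = ≤-refl

𝟙-+-𝟙-not : ∀ b → 𝟙 b + 𝟙 (not b) ≡ 1
𝟙-+-𝟙-not true  = refl
𝟙-+-𝟙-not false = refl

𝟙-not-∧-≤ : ∀ a b → 𝟙 (not (a ∧ b)) ≤ 𝟙 (not a) + 𝟙 (not b)
𝟙-not-∧-≤ true  b = ≤-refl
𝟙-not-∧-≤ false b = s≤s z≤n

module _ {A : Set} where

  length-filterᵇ : ∀ (p : A → Bool) xs → length (filterᵇ p xs) ≡ ∑[ x ∈ xs ] 𝟙 (p x)
  length-filterᵇ p [] = refl
  length-filterᵇ p (x ∷ xs) with p x
  ... | true  = cong suc (length-filterᵇ p xs)
  ... | false = length-filterᵇ p xs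

  𝟙-any-≤ : ∀ (p : A → Bool) xs → 𝟙 (any p xs) ≤ ∑[ x ∈ xs ] 𝟙 (p x)
  𝟙-any-≤ p []       = z≤n
  𝟙-any-≤ p (x ∷ xs) = ≤-trans (𝟙-∨-≤ (p x) (any p xs)) (+-monoʳ-≤ (𝟙 (p x)) (𝟙-any-≤ p xs))

  ∑-++ : ∀ (f : A → ℕ) xs ys → ∑ f (xs ++ ys) ≡ ∑ f xs + ∑ f ys
  ∑-++ f []       ys = refl
  ∑-++ f (x ∷ xs) ys = trans (cong (f x +_) (∑-++ f xs ys)) (sym (+-assoc (f x) _ _))

  ∑-cong : ∀ {f g : A → ℕ} → (∀ x → f x ≡ g x) → ∀ xs → ∑ f xs ≡ ∑ g xs
  ∑-cong f≗g []       = refl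
  ∑-cong f≗g (x ∷ xs) = cong₂ _+_ (f≗g x) (∑-cong f≗g xs)

  ∑-mono : ∀ {f g : A → ℕ} → (∀ x → f x ≤ g x) → ∀ xs → ∑ f xs ≤ ∑ g xs
  ∑-mono f≤g []       = z≤n
  ∑-mono f≤g (x ∷ xs) = +-mono-≤ (f≤g x) (∑-mono f≤g xs)

  ∑-mono-∈ : ∀ {f g : A → ℕ} xs → (∀ x → x ∈ xs → f x ≤ g x) → ∑ f xs ≤ ∑ g xs
  ∑-mono-∈ []       f≤g = z≤n
  ∑-mono-∈ (x ∷ xs) f≤g = +-mono-≤ (f≤g x (here refl)) (∑-mono-∈ xs (λ y → f≤g y ∘ there))

  ∑-cong-∈ : ∀ {f g : A → ℕ} xs → (∀ x → x ∈ xs → f x ≡ g x) → ∑ f xs ≡ ∑ g xs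
  ∑-cong-∈ []       f≗g = refl
  ∑-cong-∈ (x ∷ xs) f≗g = cong₂ _+_ (f≗g x (here refl)) (∑-cong-∈ xs (λ y → f≗g y ∘ there))

  ∑-+ : ∀ (f g : A → ℕ) xs → ∑[ x ∈ xs ] (f x + g x) ≡ ∑ f xs + ∑ g xs
  ∑-+ f g []       = refl
  ∑-+ f g (x ∷ xs) =
    trans (cong (f x + g x +_) (∑-+ f g xs)) (+-interchange (f x) (g x) (∑ f xs) (∑ g xs))

  ∑-*ˡ : ∀ c (f : A → ℕ) xs → ∑[ x ∈ xs ] (c * f x) ≡ c * ∑ f xs
  ∑-*ˡ c f []       = sym (*-zeroʳ c)
  ∑-*ˡ c f (x ∷ xs) = trans (cong (c * f x +_) (∑-*ˡ c f xs)) (sym (*-distribˡ-+ c (f x) _))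

  ∑-*ʳ : ∀ c (f : A → ℕ) xs → ∑[ x ∈ xs ] (f x * c) ≡ ∑ f xs * c
  ∑-*ʳ c f xs = trans (∑-cong (λ x → *-comm (f x) c) xs) (trans (∑-*ˡ c f xs) (*-comm c (∑ f xs)))

  ∑-const : ∀ c (xs : List A) → ∑[ _ ∈ xs ] c ≡ length xs * c
  ∑-const c []       = refl
  ∑-const c (x ∷ xs) = cong (c +_) (∑-const c xs)

  ∑-zero : ∀ {f : A → ℕ} → (∀ x → f x ≡ 0) → ∀ xs → ∑ f xs ≡ 0
  ∑-zero f≗0 xs = trans (∑-cong f≗0 xs) (trans (∑-const 0 xs) (*-zeroʳ (length xs)))

  𝟙-not-all-≤ : ∀ (p : A → Bool) xs → 𝟙 (not (all p xs)) ≤ ∑[ x ∈ xs ] 𝟙 (not (p x))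
  𝟙-not-all-≤ p []       = z≤n
  𝟙-not-all-≤ p (x ∷ xs) with p x
  ... | true  = 𝟙-not-all-≤ p xs
  ... | false = s≤s z≤n

module _ {A B : Set} where

  ∑-map : ∀ (f : B → ℕ) (g : A → B) xs → ∑ f (map g xs) ≡ ∑ (f ∘ g) xs
  ∑-map f g []       = refl
  ∑-map f g (x ∷ xs) = cong (f (g x) +_) (∑-map f g xs)

  ∑-concatMap : ∀ (f : B → ℕ) (g : A → List B) xs →
                ∑ f (concatMap g xs) ≡ ∑[ x ∈ xs ] ∑ f (g x)
  ∑-concatMap f g []       = refl
  ∑-concatMap f g (x ∷ xs) =
    trans (∑-++ f (g x) (concatMap g xs)) (cong (∑ f (g x) +_) (∑-concatMap f g xs))

  ∑-comm : ∀ (f : A → B → ℕ) xs ys → ∑[ x ∈ xs ] ∑[ y ∈ ys ] f x y ≡ ∑[ y ∈ ys ] ∑[ x ∈ xs ] f x y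
  ∑-comm f []       ys = sym (∑-zero (λ _ → refl) ys)
  ∑-comm f (x ∷ xs) ys =
    trans (cong (∑ (f x) ys +_) (∑-comm f xs ys)) (sym (∑-+ (f x) (λ y → ∑[ x′ ∈ xs ] f x′ y) ys))

∑-allFin-suc : ∀ {n} (f : Fin (suc n) → ℕ) → ∑ f (allFin (suc n)) ≡ f zero + ∑ (f ∘ suc) (allFin n)
∑-allFin-suc {n} f =
  cong (f zero +_) (trans (cong (∑ f) (sym (map-tabulate id suc))) (∑-map f suc (allFin n)))

∑-allFin-const : ∀ n c → ∑[ _ ∈ allFin n ] c ≡ n * c
∑-allFin-const n c = trans (∑-const c (allFin n)) (cong (_* c) (length-tabulate {n = n} id))

-- Tuples

module _ {n : ℕ} where

  tuples : ℕ → List (List (Fin n))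
  tuples zero    = [ [] ]
  tuples (suc m) = concatMap (λ xs → map (_∷ xs) (allFin n)) (tuples m)

  ∑-tuples-suc : ∀ m (f : List (Fin n) → ℕ) →
                 ∑ f (tuples (suc m)) ≡ ∑[ xs ∈ tuples m ] ∑[ a ∈ allFin n ] f (a ∷ xs)
  ∑-tuples-suc m f =
    trans (∑-concatMap f _ (tuples m)) (∑-cong (λ xs → ∑-map f (_∷ xs) (allFin n)) (tuples m))

  ∑-tuples-const : ∀ m c → ∑[ _ ∈ tuples m ] c ≡ n ^ m * c
  ∑-tuples-const zero    c = refl
  ∑-tuples-const (suc m) c = begin
    ∑[ _ ∈ tuples (suc m) ] c  ≡⟨ ∑-tuples-suc m (λ _ → c) ⟩
    ∑[ _ ∈ tuples m ] ∑[ _ ∈ allFin n ] c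
      ≡⟨ ∑-cong (λ _ → ∑-allFin-const n c) (tuples m) ⟩
    ∑[ _ ∈ tuples m ] (n * c)  ≡⟨ ∑-tuples-const m (n * c) ⟩
    n ^ m * (n * c)            ≡⟨ sym (*-assoc (n ^ m) n c) ⟩
    n ^ m * n * c              ≡⟨ cong (_* c) (*-comm (n ^ m) n) ⟩
    n ^ suc m * c              ∎
    where open ≡-Reasoning

  ∑-allTuples : ∀ m (f : List (Fin n) → ℕ) → ∑[ x ∈ allTuples m n ] f (toList x) ≡ ∑ f (tuples m)
  ∑-allTuples zero    f = refl
  ∑-allTuples (suc m) f = begin
    ∑[ x ∈ allTuples (suc m) n ] f (toList x)
      ≡⟨ ∑-concatMap (f ∘ toList) _ (allTuples m n) ⟩
    ∑[ x ∈ allTuples m n ] ∑ (f ∘ toList) (map (Vec._∷ x) (allFin n))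
      ≡⟨ ∑-cong (λ x → ∑-map (f ∘ toList) (Vec._∷ x) (allFin n)) (allTuples m n) ⟩
    ∑[ x ∈ allTuples m n ] ∑[ a ∈ allFin n ] f (a ∷ toList x)
      ≡⟨ ∑-allTuples m (λ xs → ∑[ a ∈ allFin n ] f (a ∷ xs)) ⟩
    ∑[ xs ∈ tuples m ] ∑[ a ∈ allFin n ] f (a ∷ xs)
      ≡⟨ sym (∑-tuples-suc m f) ⟩
    ∑ f (tuples (suc m)) ∎
    where open ≡-Reasoning

  ∑-tuples-mono : ∀ m {f g : List (Fin n) → ℕ} → (∀ xs → length xs ≡ m → f xs ≤ g xs) →
                  ∑ f (tuples m) ≤ ∑ g (tuples m)
  ∑-tuples-mono zero    f≤g = +-monoˡ-≤ 0 (f≤g [] refl)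
  ∑-tuples-mono (suc m) {f} {g} f≤g = begin
    ∑ f (tuples (suc m))                              ≡⟨ ∑-tuples-suc m f ⟩
    ∑[ xs ∈ tuples m ] ∑[ a ∈ allFin n ] f (a ∷ xs)
      ≤⟨ ∑-tuples-mono m (λ xs ∣xs∣ → ∑-mono (λ a → f≤g (a ∷ xs) (cong suc ∣xs∣)) (allFin n)) ⟩
    ∑[ xs ∈ tuples m ] ∑[ a ∈ allFin n ] g (a ∷ xs)  ≡⟨ sym (∑-tuples-suc m g) ⟩
    ∑ g (tuples (suc m))                              ∎
    where open ≤-Reasoning

  ∑-tuples-take : ∀ i m (f : List (Fin n) → ℕ) → i ≤ m →
                  ∑[ xs ∈ tuples m ] f (take i xs) ≡ n ^ (m ∸ i) * ∑ f (tuples i)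
  ∑-tuples-take zero    m       f _ = trans (∑-tuples-const m (f [])) (cong (n ^ m *_) (sym (+-identityʳ (f []))))
  ∑-tuples-take (suc i) (suc m) f (s≤s i≤m) = begin
    ∑[ xs ∈ tuples (suc m) ] f (take (suc i) xs)
      ≡⟨ ∑-tuples-suc m _ ⟩
    ∑[ xs ∈ tuples m ] ∑[ a ∈ allFin n ] f (a ∷ take i xs)
      ≡⟨ ∑-comm (λ xs a → f (a ∷ take i xs)) (tuples m) (allFin n) ⟩
    ∑[ a ∈ allFin n ] ∑[ xs ∈ tuples m ] f (a ∷ take i xs)
      ≡⟨ ∑-cong (λ a → ∑-tuples-take i m (f ∘ (a ∷_)) i≤m) (allFin n) ⟩
    ∑[ a ∈ allFin n ] (n ^ (m ∸ i) * ∑[ ys ∈ tuples i ] f (a ∷ ys))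
      ≡⟨ ∑-*ˡ (n ^ (m ∸ i)) _ (allFin n) ⟩
    n ^ (m ∸ i) * ∑[ a ∈ allFin n ] ∑[ ys ∈ tuples i ] f (a ∷ ys)
      ≡⟨ cong (n ^ (m ∸ i) *_) (sym (∑-comm (λ ys a → f (a ∷ ys)) (tuples i) (allFin n))) ⟩
    n ^ (m ∸ i) * ∑[ ys ∈ tuples i ] ∑[ a ∈ allFin n ] f (a ∷ ys)
      ≡⟨ cong (n ^ (m ∸ i) *_) (sym (∑-tuples-suc i f)) ⟩
    n ^ (m ∸ i) * ∑ f (tuples (suc i)) ∎
    where open ≡-Reasoning

  ∑-tuples-∷ʳ : ∀ m (f : List (Fin n) → ℕ) →
                ∑ f (tuples (suc m)) ≡ ∑[ xs ∈ tuples m ] ∑[ a ∈ allFin n ] f (xs ++ [ a ])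
  ∑-tuples-∷ʳ zero    f = ∑-tuples-suc zero f
  ∑-tuples-∷ʳ (suc m) f = begin
    ∑ f (tuples (suc (suc m)))
      ≡⟨ ∑-tuples-suc (suc m) f ⟩
    ∑[ ys ∈ tuples (suc m) ] ∑[ a ∈ allFin n ] f (a ∷ ys)
      ≡⟨ ∑-tuples-∷ʳ m _ ⟩
    ∑[ xs ∈ tuples m ] ∑[ b ∈ allFin n ] ∑[ a ∈ allFin n ] f (a ∷ (xs ++ [ b ]))
      ≡⟨ ∑-cong (λ xs → ∑-comm (λ b a → f (a ∷ (xs ++ [ b ]))) (allFin n) (allFin n)) (tuples m) ⟩
    ∑[ xs ∈ tuples m ] ∑[ a ∈ allFin n ] ∑[ b ∈ allFin n ] f ((a ∷ xs) ++ [ b ])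
      ≡⟨ sym (∑-tuples-suc m _) ⟩
    ∑[ ys ∈ tuples (suc m) ] ∑[ b ∈ allFin n ] f (ys ++ [ b ]) ∎
    where open ≡-Reasoning

  ∑-tuples-reverse : ∀ m (f : List (Fin n) → ℕ) → ∑[ xs ∈ tuples m ] f (reverse xs) ≡ ∑ f (tuples m)
  ∑-tuples-reverse zero    f = refl
  ∑-tuples-reverse (suc m) f = begin
    ∑[ xs ∈ tuples (suc m) ] f (reverse xs)
      ≡⟨ ∑-tuples-suc m _ ⟩
    ∑[ xs ∈ tuples m ] ∑[ a ∈ allFin n ] f (reverse (a ∷ xs))
      ≡⟨ ∑-cong (λ xs → ∑-cong (λ a → cong f (unfold-reverse a xs)) (allFin n)) (tuples m) ⟩
    ∑[ xs ∈ tuples m ] ∑[ a ∈ allFin n ] f (reverse xs ++ [ a ])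
      ≡⟨ ∑-tuples-reverse m (λ ys → ∑[ a ∈ allFin n ] f (ys ++ [ a ])) ⟩
    ∑[ ys ∈ tuples m ] ∑[ a ∈ allFin n ] f (ys ++ [ a ])
      ≡⟨ sym (∑-tuples-∷ʳ m f) ⟩
    ∑ f (tuples (suc m)) ∎
    where open ≡-Reasoning

-- Distinct entries

module _ {n : ℕ} where

  ≡ᵇ-false⇒≢ : ∀ {x y : Fin n} → (toℕ x ≡ᵇ toℕ y) ≡ false → x ≢ y
  ≡ᵇ-false⇒≢ {x} e refl = subst T e (≡⇒≡ᵇ (toℕ x) (toℕ x) refl)

  ≢⇒≡ᵇ-false : ∀ {x y : Fin n} → x ≢ y → (toℕ x ≡ᵇ toℕ y) ≡ false
  ≢⇒≡ᵇ-false {x} {y} x≢y with toℕ x ≡ᵇ toℕ y in e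
  ... | false = refl
  ... | true  = ⊥-elim (x≢y (toℕ-injective (≡ᵇ⇒≡ (toℕ x) (toℕ y) (subst T (sym e) tt))))

  not-any⇒All≢ : ∀ x (ys : List (Fin n)) → any (λ y → toℕ x ≡ᵇ toℕ y) ys ≡ false → All (x ≢_) ys
  not-any⇒All≢ x []       _ = []
  not-any⇒All≢ x (y ∷ ys) e with toℕ x ≡ᵇ toℕ y in x≢y
  ... | false = ≡ᵇ-false⇒≢ x≢y ∷ not-any⇒All≢ x ys e

  All≢⇒not-any : ∀ x {ys : List (Fin n)} → All (x ≢_) ys → any (λ y → toℕ x ≡ᵇ toℕ y) ys ≡ false
  All≢⇒not-any x []             = refl
  All≢⇒not-any x (x≢y ∷ x∉ys) rewrite ≢⇒≡ᵇ-false x≢y = All≢⇒not-any x x∉ys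

  distinctᵇ⇒Unique : ∀ (xs : List (Fin n)) → distinctᵇ xs ≡ true → Unique xs
  distinctᵇ⇒Unique []       _ = []
  distinctᵇ⇒Unique (x ∷ xs) d with any (λ y → toℕ x ≡ᵇ toℕ y) xs in x∉xs | distinctᵇ xs in dxs
  ... | false | true = not-any⇒All≢ x xs x∉xs ∷ distinctᵇ⇒Unique xs dxs

  Unique⇒distinctᵇ : ∀ {xs : List (Fin n)} → Unique xs → distinctᵇ xs ≡ true
  Unique⇒distinctᵇ []                   = refl
  Unique⇒distinctᵇ {x ∷ xs} (x∉xs ∷ u) rewrite All≢⇒not-any x x∉xs = Unique⇒distinctᵇ u

Unique-reverse : ∀ {A : Set} (xs : List A) → Unique xs → Unique (reverse xs)
Unique-reverse {A} xs = Permutation.Unique-resp-↭ (setoid A) (↭⇒↭ₛ (↭-sym (↭-reverse xs)))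

-- k-sets containing a given set

infix 7 _⊆ᵇ_
_⊆ᵇ_ : ∀ {n} → Subset n → Subset n → Bool
[]          ⊆ᵇ []      = true
(true ∷ A)  ⊆ᵇ (s ∷ S) = s ∧ A ⊆ᵇ S
(false ∷ A) ⊆ᵇ (_ ∷ S) = A ⊆ᵇ S

⊆ᵇ⇒∣∣≤ : ∀ {n} (A S : Subset n) → A ⊆ᵇ S ≡ true → ∣ A ∣ ≤ ∣ S ∣
⊆ᵇ⇒∣∣≤ []          []         _   = z≤n
⊆ᵇ⇒∣∣≤ (true ∷ A)  (true ∷ S)  A⊆S = s≤s (⊆ᵇ⇒∣∣≤ A S A⊆S)
⊆ᵇ⇒∣∣≤ (false ∷ A) (true ∷ S)  A⊆S = m≤n⇒m≤1+n (⊆ᵇ⇒∣∣≤ A S A⊆S)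
⊆ᵇ⇒∣∣≤ (false ∷ A) (false ∷ S) A⊆S = ⊆ᵇ⇒∣∣≤ A S A⊆S

∑-allSubsets-suc : ∀ n (f : Subset (suc n) → ℕ) →
  ∑ f (allSubsets (suc n)) ≡ ∑[ S ∈ allSubsets n ] f (inside ∷ S) + ∑[ S ∈ allSubsets n ] f (outside ∷ S)
∑-allSubsets-suc n f =
  trans (∑-++ f (map (inside ∷_) (allSubsets n)) _)
        (cong₂ _+_ (∑-map f _ (allSubsets n)) (∑-map f _ (allSubsets n)))

#supersets : ∀ {n} → ℕ → Subset n → ℕ
#supersets {n} k A = ∑[ S ∈ allSubsets n ] 𝟙 ((∣ S ∣ ≡ᵇ k) ∧ A ⊆ᵇ S)

#supersets-< : ∀ {n} k (A : Subset n) → k < ∣ A ∣ → #supersets k A ≡ 0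
#supersets-< {n} k A k<∣A∣ = ∑-zero none (allSubsets n)
  where
  none : ∀ S → 𝟙 ((∣ S ∣ ≡ᵇ k) ∧ A ⊆ᵇ S) ≡ 0
  none S with ∣ S ∣ ≡ᵇ k in ∣S∣≡k | A ⊆ᵇ S in A⊆S
  ... | false | _     = refl
  ... | true  | false = refl
  ... | true  | true  = ⊥-elim (<⇒≱ k<∣A∣
    (subst (∣ A ∣ ≤_) (≡ᵇ⇒≡ ∣ S ∣ k (subst T (sym ∣S∣≡k) tt)) (⊆ᵇ⇒∣∣≤ A S A⊆S)))

#supersets-≡ : ∀ {n} k (A : Subset n) → ∣ A ∣ ≤ k → #supersets k A ≡ (n ∸ ∣ A ∣) C (k ∸ ∣ A ∣)
#supersets-≡ {zero}  zero    []          _ = refl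
#supersets-≡ {zero}  (suc k) []          _ = refl
#supersets-≡ {suc n} (suc k) (true ∷ A)  (s≤s ∣A∣≤k) = begin
  #supersets (suc k) (true ∷ A)         ≡⟨ ∑-allSubsets-suc n _ ⟩
  #supersets k A + ∑[ S ∈ allSubsets n ] 𝟙 ((∣ S ∣ ≡ᵇ suc k) ∧ false)
    ≡⟨ cong (#supersets k A +_) (∑-zero (λ S → cong 𝟙 (∧-zeroʳ _)) (allSubsets n)) ⟩
  #supersets k A + 0                    ≡⟨ +-identityʳ _ ⟩
  #supersets k A                        ≡⟨ #supersets-≡ k A ∣A∣≤k ⟩
  (n ∸ ∣ A ∣) C (k ∸ ∣ A ∣)            ∎
  where open ≡-Reasoning
#supersets-≡ {suc n} zero    (false ∷ A) ∣A∣≤0 = begin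
  #supersets zero (false ∷ A)        ≡⟨ ∑-allSubsets-suc n _ ⟩
  ∑[ _ ∈ allSubsets n ] 0 + #supersets zero A
    ≡⟨ cong (_+ #supersets zero A) (∑-zero (λ _ → refl) (allSubsets n)) ⟩
  #supersets zero A                  ≡⟨ #supersets-≡ zero A ∣A∣≤0 ⟩
  (n ∸ ∣ A ∣) C (0 ∸ ∣ A ∣)         ≡⟨ cong ((n ∸ ∣ A ∣) C_) (0∸n≡0 ∣ A ∣) ⟩
  1                                  ≡⟨ sym (cong ((suc n ∸ ∣ A ∣) C_) (0∸n≡0 ∣ A ∣)) ⟩
  (suc n ∸ ∣ A ∣) C (0 ∸ ∣ A ∣)     ∎
  where open ≡-Reasoning
#supersets-≡ {suc n} (suc k) (false ∷ A) ∣A∣≤1+k with ∣ A ∣ ≤? k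
... | yes ∣A∣≤k = begin
  #supersets (suc k) (false ∷ A)        ≡⟨ ∑-allSubsets-suc n _ ⟩
  #supersets k A + #supersets (suc k) A
    ≡⟨ cong₂ _+_ (#supersets-≡ k A ∣A∣≤k) (#supersets-≡ (suc k) A ∣A∣≤1+k) ⟩
  (n ∸ ∣ A ∣) C (k ∸ ∣ A ∣) + (n ∸ ∣ A ∣) C (suc k ∸ ∣ A ∣)
    ≡⟨ cong (λ j → (n ∸ ∣ A ∣) C (k ∸ ∣ A ∣) + (n ∸ ∣ A ∣) C j) (+-∸-assoc 1 ∣A∣≤k) ⟩
  (n ∸ ∣ A ∣) C (k ∸ ∣ A ∣) + (n ∸ ∣ A ∣) C suc (k ∸ ∣ A ∣)
    ≡⟨ nCk+nC[k+1]≡[n+1]C[k+1] (n ∸ ∣ A ∣) (k ∸ ∣ A ∣) ⟩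
  suc (n ∸ ∣ A ∣) C suc (k ∸ ∣ A ∣)
    ≡⟨ cong₂ _C_ (sym (+-∸-assoc 1 (∣p∣≤n A))) (sym (+-∸-assoc 1 ∣A∣≤k)) ⟩
  (suc n ∸ ∣ A ∣) C (suc k ∸ ∣ A ∣) ∎
  where open ≡-Reasoning
... | no ∣A∣≰k = begin
  #supersets (suc k) (false ∷ A)        ≡⟨ ∑-allSubsets-suc n _ ⟩
  #supersets k A + #supersets (suc k) A
    ≡⟨ cong₂ _+_ (#supersets-< k A (≰⇒> ∣A∣≰k)) (#supersets-≡ (suc k) A ∣A∣≤1+k) ⟩
  (n ∸ ∣ A ∣) C (suc k ∸ ∣ A ∣)     ≡⟨ cong ((n ∸ ∣ A ∣) C_) 1+k∸∣A∣≡0 ⟩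
  1                                  ≡⟨ sym (cong ((suc n ∸ ∣ A ∣) C_) 1+k∸∣A∣≡0) ⟩
  (suc n ∸ ∣ A ∣) C (suc k ∸ ∣ A ∣) ∎
  where
  open ≡-Reasoning
  1+k∸∣A∣≡0 : suc k ∸ ∣ A ∣ ≡ 0
  1+k∸∣A∣≡0 = m≤n⇒m∸n≡0 (≰⇒> ∣A∣≰k)

module _ {n : ℕ} where

  fromList : List (Fin n) → Subset n
  fromList []       = ⊥
  fromList (y ∷ ys) = fromList ys [ y ]≔ inside

  ⊥⊆ᵇ : ∀ (S : Subset n) → ⊥ ⊆ᵇ S ≡ true
  ⊥⊆ᵇ S = go S
    where
    go : ∀ {m} (S : Subset m) → ⊥ ⊆ᵇ S ≡ true
    go []      = refl
    go (_ ∷ S) = go S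

  [y]≔inside-⊆ᵇ : ∀ (A S : Subset n) y → (A [ y ]≔ inside) ⊆ᵇ S ≡ lookup S y ∧ A ⊆ᵇ S
  [y]≔inside-⊆ᵇ A S y = go A S y
    where
    go : ∀ {m} (A S : Subset m) y → (A [ y ]≔ inside) ⊆ᵇ S ≡ lookup S y ∧ A ⊆ᵇ S
    go (true  ∷ A) (s ∷ S) zero = sym (trans (sym (∧-assoc s s _)) (cong (_∧ A ⊆ᵇ S) (∧-idem s)))
    go (false ∷ A) (s ∷ S) zero = refl
    go (true  ∷ A) (s ∷ S) (suc y) rewrite go A S y = ∧-comm-∧ s (lookup S y) (A ⊆ᵇ S)
      where
      ∧-comm-∧ : ∀ a b c → a ∧ (b ∧ c) ≡ b ∧ (a ∧ c)
      ∧-comm-∧ a b c = trans (sym (∧-assoc a b c)) (trans (cong (_∧ c) (∧-comm a b)) (∧-assoc b a c))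
    go (false ∷ A) (s ∷ S) (suc y) = go A S y

  ∣[y]≔inside∣ : ∀ (A : Subset n) y → lookup A y ≡ outside → ∣ A [ y ]≔ inside ∣ ≡ suc ∣ A ∣
  ∣[y]≔inside∣ A y = go A y
    where
    go : ∀ {m} (A : Subset m) y → lookup A y ≡ outside → ∣ A [ y ]≔ inside ∣ ≡ suc ∣ A ∣
    go (false ∷ A) zero    _ = refl
    go (true  ∷ A) (suc y) e = cong suc (go A y e)
    go (false ∷ A) (suc y) e = go A y e

  fromList-⊆ᵇ : ∀ ys (S : Subset n) → fromList ys ⊆ᵇ S ≡ all (lookup S) ys
  fromList-⊆ᵇ []       S = ⊥⊆ᵇ S
  fromList-⊆ᵇ (y ∷ ys) S =
    trans ([y]≔inside-⊆ᵇ (fromList ys) S y) (cong (lookup S y ∧_) (fromList-⊆ᵇ ys S))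

  lookup-fromList-∉ : ∀ y {ys} → All (y ≢_) ys → lookup (fromList ys) y ≡ outside
  lookup-fromList-∉ y {[]}     []           = lookup-replicate y outside
  lookup-fromList-∉ y {z ∷ zs} (y≢z ∷ y∉zs) =
    trans (lookup∘update′ y≢z (fromList zs) inside) (lookup-fromList-∉ y y∉zs)

  ∣fromList∣ : ∀ {ys} → Unique ys → ∣ fromList ys ∣ ≡ length ys
  ∣fromList∣ []           = ∣⊥∣≡0 n
  ∣fromList∣ {y ∷ ys} (y∉ys ∷ u) =
    trans (∣[y]≔inside∣ (fromList ys) y (lookup-fromList-∉ y y∉ys)) (cong suc (∣fromList∣ u))

  #supersets-fromList : ∀ k ys → Unique ys → length ys ≤ k →
    ∑[ S ∈ allSubsets n ] 𝟙 ((∣ S ∣ ≡ᵇ k) ∧ all (lookup S) ys) ≡ (n ∸ length ys) C (k ∸ length ys)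
  #supersets-fromList k ys u ∣ys∣≤k = begin
    ∑[ S ∈ allSubsets n ] 𝟙 ((∣ S ∣ ≡ᵇ k) ∧ all (lookup S) ys)
      ≡⟨ ∑-cong (λ S → cong (λ b → 𝟙 ((∣ S ∣ ≡ᵇ k) ∧ b)) (sym (fromList-⊆ᵇ ys S))) (allSubsets n) ⟩
    #supersets k (fromList ys)
      ≡⟨ #supersets-≡ k (fromList ys) (subst (_≤ k) (sym (∣fromList∣ u)) ∣ys∣≤k) ⟩
    (n ∸ ∣ fromList ys ∣) C (k ∸ ∣ fromList ys ∣)
      ≡⟨ cong (λ j → (n ∸ j) C (k ∸ j)) (∣fromList∣ u) ⟩
    (n ∸ length ys) C (k ∸ length ys) ∎
    where open ≡-Reasoning

∑-lookup : ∀ {n} (S : Subset n) → ∑[ a ∈ allFin n ] 𝟙 (lookup S a) ≡ ∣ S ∣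
∑-lookup []      = refl
∑-lookup (s ∷ S) = trans (∑-allFin-suc (𝟙 ∘ lookup (s ∷ S))) (go s)
  where
  go : ∀ s → 𝟙 s + ∑[ a ∈ allFin _ ] 𝟙 (lookup S a) ≡ ∣ s ∷ S ∣
  go true  = cong suc (∑-lookup S)
  go false = ∑-lookup S

∑-tuples-all-lookup : ∀ {n} (S : Subset n) i → ∑[ ys ∈ tuples i ] 𝟙 (all (lookup S) ys) ≡ ∣ S ∣ ^ i
∑-tuples-all-lookup S zero    = refl
∑-tuples-all-lookup {n} S (suc i) = begin
  ∑[ ys ∈ tuples (suc i) ] 𝟙 (all (lookup S) ys)
    ≡⟨ ∑-tuples-suc i _ ⟩
  ∑[ ys ∈ tuples i ] ∑[ a ∈ allFin n ] 𝟙 (lookup S a ∧ all (lookup S) ys)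
    ≡⟨ ∑-cong (λ ys → ∑-cong (λ a → 𝟙-∧ (lookup S a) _) (allFin n)) (tuples i) ⟩
  ∑[ ys ∈ tuples i ] ∑[ a ∈ allFin n ] (𝟙 (lookup S a) * 𝟙 (all (lookup S) ys))
    ≡⟨ ∑-cong (λ ys → ∑-*ʳ (𝟙 (all (lookup S) ys)) _ (allFin n)) (tuples i) ⟩
  ∑[ ys ∈ tuples i ] (∑[ a ∈ allFin n ] 𝟙 (lookup S a) * 𝟙 (all (lookup S) ys))
    ≡⟨ ∑-cong (λ ys → cong (_* 𝟙 (all (lookup S) ys)) (∑-lookup S)) (tuples i) ⟩
  ∑[ ys ∈ tuples i ] (∣ S ∣ * 𝟙 (all (lookup S) ys))
    ≡⟨ ∑-*ˡ ∣ S ∣ _ (tuples i) ⟩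
  ∣ S ∣ * ∑[ ys ∈ tuples i ] 𝟙 (all (lookup S) ys)
    ≡⟨ cong (∣ S ∣ *_) (∑-tuples-all-lookup S i) ⟩
  ∣ S ∣ ^ suc i ∎
  where open ≡-Reasoning

-- Binomial coefficients

C-suc-≤ : ∀ a b → suc a C suc b ≤ suc a * (a C b)
C-suc-≤ zero    zero    = ≤-refl
C-suc-≤ zero    (suc b) = z≤n
C-suc-≤ (suc a) zero    = ≤-reflexive (trans (nC1≡n (suc (suc a))) (sym (*-identityʳ (suc (suc a)))))
C-suc-≤ (suc a) (suc b) = begin
  suc (suc a) C suc (suc b)                 ≡⟨ sym (nCk+nC[k+1]≡[n+1]C[k+1] (suc a) (suc b)) ⟩
  suc a C suc b + suc a C suc (suc b)       ≤⟨ +-mono-≤ (C-suc-≤ a b) (C-suc-≤ a (suc b)) ⟩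
  suc a * (a C b) + suc a * (a C suc b)     ≡⟨ sym (*-distribˡ-+ (suc a) (a C b) (a C suc b)) ⟩
  suc a * (a C b + a C suc b)               ≡⟨ cong (suc a *_) (nCk+nC[k+1]≡[n+1]C[k+1] a b) ⟩
  suc a * (suc a C suc b)                   ≤⟨ *-monoˡ-≤ (suc a C suc b) (n≤1+n (suc a)) ⟩
  suc (suc a) * (suc a C suc b)             ∎
  where open ≤-Reasoning

C-pos : ∀ a b → b ≤ a → 0 < a C b
C-pos a       zero    _         = s≤s z≤n
C-pos (suc a) (suc b) (s≤s b≤a) = begin-strict
  0                       <⟨ C-pos a b b≤a ⟩
  a C b                   ≤⟨ m≤m+n (a C b) (a C suc b) ⟩
  a C b + a C suc b       ≡⟨ nCk+nC[k+1]≡[n+1]C[k+1] a b ⟩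
  suc a C suc b           ∎
  where open ≤-Reasoning

C-≤-^*C : ∀ j a b → j ≤ b → a C b ≤ a ^ j * ((a ∸ j) C (b ∸ j))
C-≤-^*C zero    a       b       _         = ≤-reflexive (sym (+-identityʳ (a C b)))
C-≤-^*C (suc j) zero    (suc b) _         = z≤n
C-≤-^*C (suc j) (suc a) (suc b) (s≤s j≤b) = begin
  suc a C suc b                                   ≤⟨ C-suc-≤ a b ⟩
  suc a * (a C b)                                 ≤⟨ *-monoʳ-≤ (suc a) (C-≤-^*C j a b j≤b) ⟩
  suc a * (a ^ j * ((a ∸ j) C (b ∸ j)))
    ≤⟨ *-monoʳ-≤ (suc a) (*-monoˡ-≤ ((a ∸ j) C (b ∸ j)) (^-monoˡ-≤ j (n≤1+n a))) ⟩
  suc a * (suc a ^ j * ((a ∸ j) C (b ∸ j)))      ≡⟨ sym (*-assoc (suc a) (suc a ^ j) _) ⟩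
  suc a ^ suc j * ((a ∸ j) C (b ∸ j))            ∎
  where open ≤-Reasoning

C-≤-^*C-pred : ∀ n k j → suc j ≤ k → (n ∸ 1) C (k ∸ 1) ≤ n ^ j * ((n ∸ suc j) C (k ∸ suc j))
C-≤-^*C-pred n k j i≤k = begin
  (n ∸ 1) C (k ∸ 1)                            ≤⟨ C-≤-^*C j (n ∸ 1) (k ∸ 1) (∸-monoˡ-≤ 1 i≤k) ⟩
  (n ∸ 1) ^ j * ((n ∸ 1 ∸ j) C (k ∸ 1 ∸ j))  ≡⟨ cong₂ (λ a b → (n ∸ 1) ^ j * (a C b)) (∸-+-assoc n 1 j) (∸-+-assoc k 1 j) ⟩
  (n ∸ 1) ^ j * ((n ∸ suc j) C (k ∸ suc j))  ≤⟨ *-monoˡ-≤ _ (^-monoˡ-≤ j (m∸n≤m n 1)) ⟩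
  n ^ j * ((n ∸ suc j) C (k ∸ suc j))        ∎
  where open ≤-Reasoning

^-[k∸1]-split : ∀ d j {k} → suc j ≤ k → d ^ (k ∸ 1) ≡ d ^ j * d ^ (k ∸ suc j)
^-[k∸1]-split d j i≤k = trans (cong (d ^_) (cong pred (sym (m+[n∸m]≡n i≤k)))) (^-distribˡ-+-* d j _)

-- Non-edges

-- With a + b = C split into degree and non-degree, (1 - 1/q) C ≤ a says that at most C/q of the
-- k-sets through a tuple are non-edges.
[q∸1]*[a+b]≤q*a⇔q*b≤a+b : ∀ q a b → 1 ≤ q → (q ∸ 1) * (a + b) ≤ q * a ⇔ q * b ≤ a + b
[q∸1]*[a+b]≤q*a⇔q*b≤a+b (suc p) a b _ = mk⇔ (p*b≤a⇒right ∘ left⇒p*b≤a) (p*b≤a⇒left ∘ right⇒p*b≤a)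
  where
  open ≤-Reasoning
  left⇒p*b≤a : p * (a + b) ≤ suc p * a → p * b ≤ a
  left⇒p*b≤a h = +-cancelˡ-≤ (p * a) (p * b) a (begin
    p * a + p * b  ≡⟨ sym (*-distribˡ-+ p a b) ⟩
    p * (a + b)    ≤⟨ h ⟩
    a + p * a      ≡⟨ +-comm a (p * a) ⟩
    p * a + a      ∎)
  p*b≤a⇒left : p * b ≤ a → p * (a + b) ≤ suc p * a
  p*b≤a⇒left h = begin
    p * (a + b)    ≡⟨ *-distribˡ-+ p a b ⟩
    p * a + p * b  ≤⟨ +-monoʳ-≤ (p * a) h ⟩
    p * a + a      ≡⟨ +-comm (p * a) a ⟩
    a + p * a      ∎
  p*b≤a⇒right : p * b ≤ a → suc p * b ≤ a + b
  p*b≤a⇒right h = begin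
    b + p * b  ≤⟨ +-monoʳ-≤ b h ⟩
    b + a      ≡⟨ +-comm b a ⟩
    a + b      ∎
  right⇒p*b≤a : suc p * b ≤ a + b → p * b ≤ a
  right⇒p*b≤a h = +-cancelˡ-≤ b (p * b) a (≤-trans h (≤-reflexive (+-comm a b)))

module NonEdges {k n : ℕ} (H : KGraph k n) where

  isNonEdge : Subset n → Bool
  isNonEdge S = (∣ S ∣ ≡ᵇ k) ∧ not (edge H S)

  #nonEdges : ℕ
  #nonEdges = ∑[ S ∈ allSubsets n ] 𝟙 (isNonEdge S)

  nonDeg : List (Fin n) → ℕ
  nonDeg ys = ∑[ S ∈ allSubsets n ] 𝟙 (isNonEdge S ∧ all (lookup S) ys)

  deg+nonDeg : ∀ ys → Unique ys → length ys ≤ k →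
               deg H ys + nonDeg ys ≡ (n ∸ length ys) C (k ∸ length ys)
  deg+nonDeg ys u ∣ys∣≤k = begin
    deg H ys + nonDeg ys
      ≡⟨ cong (_+ nonDeg ys) (length-filterᵇ _ (allSubsets n)) ⟩
    ∑[ S ∈ allSubsets n ] 𝟙 (edge H S ∧ all (lookup S) ys) + nonDeg ys
      ≡⟨ sym (∑-+ _ _ (allSubsets n)) ⟩
    ∑[ S ∈ allSubsets n ] (𝟙 (edge H S ∧ all (lookup S) ys) + 𝟙 (isNonEdge S ∧ all (lookup S) ys))
      ≡⟨ ∑-cong (λ S → split (edge-size S) (all (lookup S) ys)) (allSubsets n) ⟩
    ∑[ S ∈ allSubsets n ] 𝟙 ((∣ S ∣ ≡ᵇ k) ∧ all (lookup S) ys)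
      ≡⟨ #supersets-fromList k ys u ∣ys∣≤k ⟩
    (n ∸ length ys) C (k ∸ length ys) ∎
    where
    open ≡-Reasoning
    edge-size : ∀ S → edge H S ≡ true → (∣ S ∣ ≡ᵇ k) ≡ true
    edge-size S e with ∣ S ∣ ≡ᵇ k in sized
    ... | true  = refl
    ... | false = ⊥-elim (subst T sized (≡⇒≡ᵇ ∣ S ∣ k (uniform H S (subst T (sym e) tt))))
    split : ∀ {e s} → (e ≡ true → s ≡ true) → ∀ c → 𝟙 (e ∧ c) + 𝟙 ((s ∧ not e) ∧ c) ≡ 𝟙 (s ∧ c)
    split {true}  {true}  _   c = trans (cong (𝟙 c +_) (cong 𝟙 (∧-zeroˡ c))) (+-identityʳ (𝟙 c))
    split {true}  {false} e⇒s c with () ← e⇒s refl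
    split {false} {true}  _   c = refl
    split {false} {false} _   c = refl

  -- A non-edge S is counted once for each of the ∣ S ∣ ^ i = k ^ i tuples with entries in S,
  -- repetitions included.
  ∑-nonDeg : ∀ i → ∑ nonDeg (tuples i) ≡ k ^ i * #nonEdges
  ∑-nonDeg i = begin
    ∑[ ys ∈ tuples i ] ∑[ S ∈ allSubsets n ] 𝟙 (isNonEdge S ∧ all (lookup S) ys)
      ≡⟨ ∑-comm (λ ys S → 𝟙 (isNonEdge S ∧ all (lookup S) ys)) (tuples i) (allSubsets n) ⟩
    ∑[ S ∈ allSubsets n ] ∑[ ys ∈ tuples i ] 𝟙 (isNonEdge S ∧ all (lookup S) ys)
      ≡⟨ ∑-cong (λ S → ∑-cong (λ ys → 𝟙-∧ (isNonEdge S) _) (tuples i)) (allSubsets n) ⟩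
    ∑[ S ∈ allSubsets n ] ∑[ ys ∈ tuples i ] (𝟙 (isNonEdge S) * 𝟙 (all (lookup S) ys))
      ≡⟨ ∑-cong (λ S → trans (∑-*ˡ (𝟙 (isNonEdge S)) _ (tuples i))
                             (cong (𝟙 (isNonEdge S) *_) (∑-tuples-all-lookup S i))) (allSubsets n) ⟩
    ∑[ S ∈ allSubsets n ] (𝟙 (isNonEdge S) * ∣ S ∣ ^ i)
      ≡⟨ ∑-cong nonEdge-size (allSubsets n) ⟩
    ∑[ S ∈ allSubsets n ] (k ^ i * 𝟙 (isNonEdge S))
      ≡⟨ ∑-*ˡ (k ^ i) _ (allSubsets n) ⟩
    k ^ i * #nonEdges ∎
    where
    open ≡-Reasoning
    nonEdge-size : ∀ S → 𝟙 (isNonEdge S) * ∣ S ∣ ^ i ≡ k ^ i * 𝟙 (isNonEdge S)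
    nonEdge-size S with ∣ S ∣ ≡ᵇ k in sized | edge H S
    ... | false | _     = sym (*-zeroʳ (k ^ i))
    ... | true  | true  = sym (*-zeroʳ (k ^ i))
    ... | true  | false rewrite ≡ᵇ⇒≡ ∣ S ∣ k (subst T (sym sized) tt) = trans (+-identityʳ (k ^ i)) (sym (*-identityʳ (k ^ i)))

  #nonEdges-≤ : ∀ q → 1 ≤ q → 1 ≤ k →
                (∀ v → (q ∸ 1) * ((n ∸ 1) C (k ∸ 1)) ≤ q * deg H [ v ]) →
                q * (k * #nonEdges) ≤ n * ((n ∸ 1) C (k ∸ 1))
  #nonEdges-≤ q 1≤q 1≤k minDeg = begin
    q * (k * #nonEdges)                     ≡⟨ cong (λ t → q * (t * #nonEdges)) (sym (*-identityʳ k)) ⟩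
    q * (k ^ 1 * #nonEdges)                 ≡⟨ cong (q *_) (sym (∑-nonDeg 1)) ⟩
    q * ∑ nonDeg (tuples 1)                 ≡⟨ sym (∑-*ˡ q nonDeg (tuples 1)) ⟩
    ∑[ ys ∈ tuples 1 ] (q * nonDeg ys)      ≤⟨ ∑-tuples-mono 1 vertex-bound ⟩
    ∑[ _ ∈ tuples {n} 1 ] C₁               ≡⟨ ∑-tuples-const {n} 1 C₁ ⟩
    n * 1 * C₁                             ≡⟨ cong (_* C₁) (*-identityʳ n) ⟩
    n * ((n ∸ 1) C (k ∸ 1))                ∎
    where
    open ≤-Reasoning
    C₁ : ℕ
    C₁ = (n ∸ 1) C (k ∸ 1)
    vertex-bound : ∀ ys → length ys ≡ 1 → q * nonDeg ys ≤ (n ∸ 1) C (k ∸ 1)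
    vertex-bound (v ∷ []) _ = subst (q * nonDeg [ v ] ≤_) split
      (Equivalence.to ([q∸1]*[a+b]≤q*a⇔q*b≤a+b q _ _ 1≤q) (subst (λ c → (q ∸ 1) * c ≤ q * deg H [ v ]) (sym split) (minDeg v)))
      where
      split : deg H [ v ] + nonDeg [ v ] ≡ (n ∸ 1) C (k ∸ 1)
      split = deg+nonDeg [ v ] ([] ∷ []) 1≤k

  isBad : ℕ → ℕ → List (Fin n) → Bool
  isBad q i ys = distinctᵇ ys ∧ not (atLeastFrac q (deg H ys) ((n ∸ i) C (k ∸ i)))

  #bad : ℕ → ℕ → ℕ
  #bad q i = ∑[ ys ∈ tuples i ] 𝟙 (isBad q i ys)

  #bad-*-C-≤ : ∀ q i → 1 ≤ q → i ≤ k → #bad q i * ((n ∸ i) C (k ∸ i)) ≤ q * (k ^ i * #nonEdges)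
  #bad-*-C-≤ q i 1≤q i≤k = begin
    #bad q i * Cᵢ                          ≡⟨ sym (∑-*ʳ Cᵢ _ (tuples i)) ⟩
    ∑[ ys ∈ tuples i ] (𝟙 (isBad q i ys) * Cᵢ)  ≤⟨ ∑-tuples-mono i bad-bound ⟩
    ∑[ ys ∈ tuples i ] (q * nonDeg ys)     ≡⟨ ∑-*ˡ q nonDeg (tuples i) ⟩
    q * ∑ nonDeg (tuples i)                ≡⟨ cong (q *_) (∑-nonDeg i) ⟩
    q * (k ^ i * #nonEdges)                ∎
    where
    open ≤-Reasoning
    Cᵢ : ℕ
    Cᵢ = (n ∸ i) C (k ∸ i)
    bad-bound : ∀ ys → length ys ≡ i → 𝟙 (isBad q i ys) * Cᵢ ≤ q * nonDeg ys
    bad-bound ys refl with distinctᵇ ys in d | atLeastFrac q (deg H ys) Cᵢ in dense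
    ... | false | _     = z≤n
    ... | true  | true  = z≤n
    ... | true  | false = ≤-trans (≤-reflexive (+-identityʳ Cᵢ)) (<⇒≤ (≰⇒> sparse))
      where
      split : deg H ys + nonDeg ys ≡ Cᵢ
      split = deg+nonDeg ys (distinctᵇ⇒Unique ys d) i≤k
      sparse : ¬ q * nonDeg ys ≤ Cᵢ
      sparse h = subst T dense (≤⇒≤ᵇ (subst (λ c → (q ∸ 1) * c ≤ q * deg H ys) split
        (Equivalence.from ([q∸1]*[a+b]≤q*a⇔q*b≤a+b q _ _ 1≤q) (subst (q * nonDeg ys ≤_) (sym split) h))))

-- Tuples with a repeated entry

∑-𝟙-≡ᵇ : ∀ {n} (y : Fin n) → ∑[ a ∈ allFin n ] 𝟙 (toℕ a ≡ᵇ toℕ y) ≡ 1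
∑-𝟙-≡ᵇ {suc n} zero    =
  trans (∑-allFin-suc {n} (λ a → 𝟙 (toℕ a ≡ᵇ 0))) (cong suc (∑-zero (λ _ → refl) (allFin n)))
∑-𝟙-≡ᵇ {suc n} (suc y) = trans (∑-allFin-suc {n} (λ a → 𝟙 (toℕ a ≡ᵇ toℕ (suc y)))) (∑-𝟙-≡ᵇ y)

module _ {n : ℕ} where

  ∑-𝟙-any-≡ᵇ : ∀ (ys : List (Fin n)) → ∑[ a ∈ allFin n ] 𝟙 (any (λ y → toℕ a ≡ᵇ toℕ y) ys) ≤ length ys
  ∑-𝟙-any-≡ᵇ ys = begin
    ∑[ a ∈ allFin n ] 𝟙 (any (λ y → toℕ a ≡ᵇ toℕ y) ys)
      ≤⟨ ∑-mono (λ a → 𝟙-any-≤ (λ y → toℕ a ≡ᵇ toℕ y) ys) (allFin n) ⟩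
    ∑[ a ∈ allFin n ] ∑[ y ∈ ys ] 𝟙 (toℕ a ≡ᵇ toℕ y)
      ≡⟨ ∑-comm (λ a y → 𝟙 (toℕ a ≡ᵇ toℕ y)) (allFin n) ys ⟩
    ∑[ y ∈ ys ] ∑[ a ∈ allFin n ] 𝟙 (toℕ a ≡ᵇ toℕ y)
      ≡⟨ ∑-cong ∑-𝟙-≡ᵇ ys ⟩
    ∑[ _ ∈ ys ] 1
      ≡⟨ trans (∑-const 1 ys) (*-identityʳ (length ys)) ⟩
    length ys ∎
    where open ≤-Reasoning

  #nonDistinct : ℕ → ℕ
  #nonDistinct m = ∑[ xs ∈ tuples {n} m ] 𝟙 (not (distinctᵇ xs))

  #nonDistinct-suc : ∀ m → #nonDistinct (suc m) ≤ n ^ m * m + n * #nonDistinct m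
  #nonDistinct-suc m = begin
    #nonDistinct (suc m)
      ≡⟨ ∑-tuples-suc m _ ⟩
    ∑[ xs ∈ tuples m ] ∑[ a ∈ allFin n ] 𝟙 (not (distinctᵇ (a ∷ xs)))
      ≤⟨ ∑-tuples-mono m new-collisions ⟩
    ∑[ xs ∈ tuples m ] (m + n * 𝟙 (not (distinctᵇ xs)))
      ≡⟨ ∑-+ (λ _ → m) _ (tuples m) ⟩
    ∑[ _ ∈ tuples {n} m ] m + ∑[ xs ∈ tuples m ] (n * 𝟙 (not (distinctᵇ xs)))
      ≡⟨ cong₂ _+_ (∑-tuples-const m m) (∑-*ˡ n _ (tuples m)) ⟩
    n ^ m * m + n * #nonDistinct m ∎
    where
    open ≤-Reasoning
    𝟙-not-distinct-∷ : ∀ b d → 𝟙 (not (not b ∧ d)) ≤ 𝟙 b + 𝟙 (not d)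
    𝟙-not-distinct-∷ true  d     = s≤s z≤n
    𝟙-not-distinct-∷ false true  = z≤n
    𝟙-not-distinct-∷ false false = ≤-refl
    new-collisions : ∀ xs → length xs ≡ m →
      ∑[ a ∈ allFin n ] 𝟙 (not (distinctᵇ (a ∷ xs))) ≤ m + n * 𝟙 (not (distinctᵇ xs))
    new-collisions xs refl = begin
      ∑[ a ∈ allFin n ] 𝟙 (not (distinctᵇ (a ∷ xs)))
        ≤⟨ ∑-mono (λ a → 𝟙-not-distinct-∷ (any (λ y → toℕ a ≡ᵇ toℕ y) xs) (distinctᵇ xs)) (allFin n) ⟩
      ∑[ a ∈ allFin n ] (𝟙 (any (λ y → toℕ a ≡ᵇ toℕ y) xs) + 𝟙 (not (distinctᵇ xs)))
        ≡⟨ ∑-+ _ _ (allFin n) ⟩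
      ∑[ a ∈ allFin n ] 𝟙 (any (λ y → toℕ a ≡ᵇ toℕ y) xs) + ∑[ _ ∈ allFin n ] 𝟙 (not (distinctᵇ xs))
        ≤⟨ +-mono-≤ (∑-𝟙-any-≡ᵇ xs) (≤-reflexive (∑-allFin-const n _)) ⟩
      length xs + n * 𝟙 (not (distinctᵇ xs)) ∎

  #nonDistinct-≤ : ∀ m → n * #nonDistinct m ≤ m * m * n ^ m
  #nonDistinct-≤ zero    = ≤-reflexive (*-zeroʳ n)
  #nonDistinct-≤ (suc m) = begin
    n * #nonDistinct (suc m)                          ≤⟨ *-monoʳ-≤ n (#nonDistinct-suc m) ⟩
    n * (n ^ m * m + n * #nonDistinct m)              ≡⟨ *-distribˡ-+ n (n ^ m * m) _ ⟩
    n * (n ^ m * m) + n * (n * #nonDistinct m)        ≤⟨ +-monoʳ-≤ (n * (n ^ m * m)) (*-monoʳ-≤ n (#nonDistinct-≤ m)) ⟩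
    n * (n ^ m * m) + n * (m * m * n ^ m)             ≡⟨ regroup n (n ^ m) m ⟩
    (m + m * m) * (n * n ^ m)                         ≤⟨ *-monoˡ-≤ (n * n ^ m) (m+m*m≤[1+m]*[1+m] m) ⟩
    suc m * suc m * n ^ suc m                         ∎
    where
    open ≤-Reasoning
    regroup : ∀ n nᵐ m → n * (nᵐ * m) + n * (m * m * nᵐ) ≡ (m + m * m) * (n * nᵐ)
    regroup = solve-∀
    m+m*m≤[1+m]*[1+m] : ∀ m → m + m * m ≤ suc m * suc m
    m+m*m≤[1+m]*[1+m] m = ≤-trans (m≤m+n (m + m * m) (suc m)) (≤-reflexive (expand m))
      where
      expand : ∀ m → m + m * m + suc m ≡ suc m * suc m
      expand = solve-∀

-- Bad prefixes

take-length-++ : ∀ {A : Set} (ys zs : List A) → take (length ys) (ys ++ zs) ≡ ys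
take-length-++ []       zs = refl
take-length-++ (y ∷ ys) zs = cong (y ∷_) (take-length-++ ys zs)

reverse-drop : ∀ {A : Set} m n (xs : List A) → length xs ≡ m + n → reverse (drop m xs) ≡ take n (reverse xs)
reverse-drop m n xs ∣xs∣≡m+n = sym (begin
  take n (reverse xs)                                    ≡⟨ cong (take n ∘ reverse) (sym (take++drop≡id m xs)) ⟩
  take n (reverse (take m xs ++ drop m xs))              ≡⟨ cong (take n) (reverse-++ (take m xs) (drop m xs)) ⟩
  take n (reverse (drop m xs) ++ reverse (take m xs))    ≡⟨ cong (λ l → take l (reverse (drop m xs) ++ _)) (sym ∣rev-drop∣) ⟩
  take (length (reverse (drop m xs))) (reverse (drop m xs) ++ reverse (take m xs))
                                                         ≡⟨ take-length-++ (reverse (drop m xs)) _ ⟩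
  reverse (drop m xs)                                    ∎)
  where
  open ≡-Reasoning
  ∣rev-drop∣ : length (reverse (drop m xs)) ≡ n
  ∣rev-drop∣ = begin
    length (reverse (drop m xs))  ≡⟨ length-reverse (drop m xs) ⟩
    length (drop m xs)            ≡⟨ length-drop m xs ⟩
    length xs ∸ m                 ≡⟨ cong (_∸ m) ∣xs∣≡m+n ⟩
    m + n ∸ m                     ≡⟨ m+n∸m≡n m n ⟩
    n                             ∎

1≤D : ∀ {k} → 1 ≤ k → 1 ≤ D k
1≤D 1≤k = ≤-trans (s≤s z≤n) (*-monoʳ-≤ 1280 (^-monoˡ-≤ 3 1≤k))

k*k≤D : ∀ k → k * k ≤ D k
k*k≤D zero    = z≤n
k*k≤D (suc k) = ≤-trans (m≤m*n (suc k * suc k) (suc k)) (≤-trans (≤-reflexive (k*k*k≡k^3 (suc k))) (m≤n*m _ 1280))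
  where
  k*k*k≡k^3 : ∀ k → k * k * k ≡ k ^ 3
  k*k*k≡k^3 k = trans (*-assoc k k k) (cong (λ t → k * (k * t)) (sym (*-identityʳ k)))

k≤D : ∀ k → k ≤ D k
k≤D zero    = z≤n
k≤D (suc k) = ≤-trans (m≤m*n (suc k) (suc k)) (k*k≤D (suc k))

k^[2+j]≤D^[1+j] : ∀ k j → k * k ^ suc j ≤ D k ^ suc j
k^[2+j]≤D^[1+j] k j = begin
  k * (k * k ^ j)   ≡⟨ sym (*-assoc k k (k ^ j)) ⟩
  k * k * k ^ j     ≤⟨ *-mono-≤ (k*k≤D k) (^-monoˡ-≤ j (k≤D k)) ⟩
  D k * D k ^ j     ∎
  where open ≤-Reasoning

module Events {k n : ℕ} (H : KGraph k n) where
  open NonEdges H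

  K : ℕ
  K = k ∸ 1

  isBadAt : ℕ → List (Fin n) → Bool
  isBadAt i = isBad (D k ^ (k ∸ i)) i

  #badAt : ℕ → ℕ
  #badAt i = #bad (D k ^ (k ∸ i)) i

  #badAt-≤ : MinDegCond H → ∀ j → suc j ≤ k → k ≤ n → 22 * D k ^ j * #badAt (suc j) ≤ k ^ j * n ^ suc j
  #badAt-≤ minDeg j i≤k k≤n = *-cancelˡ-≤ P {{>-nonZero 1≤P}} (*-cancelʳ-≤ _ _ Cᵢ {{>-nonZero 0<Cᵢ}} (begin
    P * (22 * D k ^ j * B) * Cᵢ       ≡⟨ cong (_* Cᵢ) (sym (*-assoc P (22 * D k ^ j) B)) ⟩
    P * (22 * D k ^ j) * B * Cᵢ       ≡⟨ cong (λ d → d * B * Cᵢ) P*22Dʲ≡Q ⟩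
    Q * B * Cᵢ                         ≡⟨ *-assoc Q B Cᵢ ⟩
    Q * (B * Cᵢ)                       ≤⟨ *-monoʳ-≤ Q (#bad-*-C-≤ P i 1≤P i≤k) ⟩
    Q * (P * (k ^ i * #nonEdges))      ≡⟨ regroup Q P (k ^ j) k #nonEdges ⟩
    P * k ^ j * (Q * (k * #nonEdges))  ≤⟨ *-monoʳ-≤ (P * k ^ j) (#nonEdges-≤ Q 1≤Q 1≤k minDeg) ⟩
    P * k ^ j * (n * C₁)               ≤⟨ *-monoʳ-≤ (P * k ^ j) (*-monoʳ-≤ n (C-≤-^*C-pred n k j i≤k)) ⟩
    P * k ^ j * (n * (n ^ j * Cᵢ))     ≡⟨ regroup′ P (k ^ j) n (n ^ j) Cᵢ ⟩
    P * (k ^ j * n ^ i) * Cᵢ           ∎))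
    where
    open ≤-Reasoning
    i : ℕ
    i = suc j
    P : ℕ
    P = D k ^ (k ∸ i)
    Q : ℕ
    Q = 22 * D k ^ (k ∸ 1)
    B : ℕ
    B = #badAt i
    Cᵢ : ℕ
    Cᵢ = (n ∸ i) C (k ∸ i)
    C₁ : ℕ
    C₁ = (n ∸ 1) C (k ∸ 1)
    1≤k : 1 ≤ k
    1≤k = ≤-trans (s≤s z≤n) i≤k
    1≤Dk : 1 ≤ D k
    1≤Dk = 1≤D 1≤k
    1≤P : 1 ≤ P
    1≤P = m^n>0 (D k) {{>-nonZero 1≤Dk}} (k ∸ i)
    1≤Q : 1 ≤ Q
    1≤Q = ≤-trans (s≤s z≤n) (*-monoʳ-≤ 22 (m^n>0 (D k) {{>-nonZero 1≤Dk}} (k ∸ 1)))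
    0<Cᵢ : 0 < Cᵢ
    0<Cᵢ = C-pos (n ∸ i) (k ∸ i) (∸-monoˡ-≤ i k≤n)
    P*22Dʲ≡Q : P * (22 * D k ^ j) ≡ Q
    P*22Dʲ≡Q = trans (x∙yz≈y∙xz P 22 (D k ^ j)) (cong (22 *_) (trans (*-comm P (D k ^ j)) (sym (^-[k∸1]-split (D k) j i≤k))))
    regroup : ∀ q p kʲ k e → q * (p * (k * kʲ * e)) ≡ p * kʲ * (q * (k * e))
    regroup = solve-∀
    regroup′ : ∀ p kʲ n nʲ c → p * kʲ * (n * (nʲ * c)) ≡ p * (kʲ * (n * nʲ)) * c
    regroup′ = solve-∀

  𝟙-not-good-≤ : ∀ xs → Unique xs →
    𝟙 (not (good H (take K xs))) ≤ ∑[ j ∈ upTo K ] 𝟙 (isBadAt (suc j) (take (suc j) xs))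
  𝟙-not-good-≤ xs u rewrite Unique⇒distinctᵇ (Unique.take⁺ K u) =
    ≤-trans (𝟙-not-all-≤ _ (upTo K)) (∑-mono-∈ (upTo K) level)
    where
    level : ∀ j → j ∈ upTo K →
      𝟙 (not (atLeastFrac (D k ^ (k ∸ suc j)) (deg H (take (suc j) (take K xs))) ((n ∸ suc j) C (k ∸ suc j))))
        ≤ 𝟙 (isBadAt (suc j) (take (suc j) xs))
    level j j∈ rewrite take-take (suc j) K xs | m≤n⇒m⊓n≡m (∈-upTo⁻ j∈)
                     | Unique⇒distinctᵇ (Unique.take⁺ (suc j) u) = ≤-refl

  isEvent : List (Fin n) → Bool
  isEvent xs = distinctᵇ xs ∧ good H (take K xs) ∧ good H (reverse (drop K xs))

  badPrefixes : ℕ → List (Fin n) → ℕ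
  badPrefixes j xs = 𝟙 (isBadAt (suc j) (take (suc j) xs)) + 𝟙 (isBadAt (suc j) (take (suc j) (reverse xs)))

  𝟙-not-event-≤ : ∀ xs → length xs ≡ K + K →
    𝟙 (not (isEvent xs)) ≤ 𝟙 (not (distinctᵇ xs)) + ∑[ j ∈ upTo K ] badPrefixes j xs
  𝟙-not-event-≤ xs ∣xs∣≡K+K with distinctᵇ xs in d
  ... | false = s≤s z≤n
  ... | true  rewrite reverse-drop K K xs ∣xs∣≡K+K = begin
    𝟙 (not (good H (take K xs) ∧ good H (take K (reverse xs))))
      ≤⟨ 𝟙-not-∧-≤ (good H (take K xs)) _ ⟩
    𝟙 (not (good H (take K xs))) + 𝟙 (not (good H (take K (reverse xs))))
      ≤⟨ +-mono-≤ (𝟙-not-good-≤ xs u) (𝟙-not-good-≤ (reverse xs) (Unique-reverse xs u)) ⟩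
    ∑[ j ∈ upTo K ] 𝟙 (isBadAt (suc j) (take (suc j) xs)) + ∑[ j ∈ upTo K ] 𝟙 (isBadAt (suc j) (take (suc j) (reverse xs)))
      ≡⟨ sym (∑-+ _ _ (upTo K)) ⟩
    ∑[ j ∈ upTo K ] badPrefixes j xs ∎
    where
    open ≤-Reasoning
    u : Unique xs
    u = distinctᵇ⇒Unique xs d

  m : ℕ
  m = K + K

  level : ℕ → ℕ
  level j = n ^ (m ∸ suc j) * #badAt (suc j)

  ∑-badPrefixes : ∀ j → suc j ≤ m → ∑[ xs ∈ tuples m ] badPrefixes j xs ≡ 2 * level j
  ∑-badPrefixes j i≤m = begin
    ∑[ xs ∈ tuples m ] badPrefixes j xs
      ≡⟨ ∑-+ _ _ (tuples m) ⟩
    ∑[ xs ∈ tuples m ] bad (take i xs) + ∑[ xs ∈ tuples m ] bad (take i (reverse xs))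
      ≡⟨ cong (∑[ xs ∈ tuples m ] bad (take i xs) +_) (∑-tuples-reverse m (bad ∘ take i)) ⟩
    ∑[ xs ∈ tuples m ] bad (take i xs) + ∑[ xs ∈ tuples m ] bad (take i xs)
      ≡⟨ cong (λ t → t + t) (∑-tuples-take i m bad i≤m) ⟩
    level j + level j
      ≡⟨ cong (level j +_) (sym (+-identityʳ (level j))) ⟩
    2 * level j ∎
    where
    open ≡-Reasoning
    i : ℕ
    i = suc j
    bad : List (Fin n) → ℕ
    bad = 𝟙 ∘ isBadAt i

  #failures-≤ : ∑[ xs ∈ tuples m ] 𝟙 (not (isEvent xs)) ≤ #nonDistinct m + 2 * ∑ level (upTo K)
  #failures-≤ = begin
    ∑[ xs ∈ tuples m ] 𝟙 (not (isEvent xs))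
      ≤⟨ ∑-tuples-mono m 𝟙-not-event-≤ ⟩
    ∑[ xs ∈ tuples m ] (𝟙 (not (distinctᵇ xs)) + ∑[ j ∈ upTo K ] badPrefixes j xs)
      ≡⟨ ∑-+ _ _ (tuples m) ⟩
    #nonDistinct m + ∑[ xs ∈ tuples m ] ∑[ j ∈ upTo K ] badPrefixes j xs
      ≡⟨ cong (#nonDistinct m +_) (∑-comm (λ xs j → badPrefixes j xs) (tuples m) (upTo K)) ⟩
    #nonDistinct m + ∑[ j ∈ upTo K ] ∑[ xs ∈ tuples m ] badPrefixes j xs
      ≡⟨ cong (#nonDistinct m +_) (∑-cong-∈ (upTo K) (λ j j∈ → ∑-badPrefixes j (≤-trans (∈-upTo⁻ j∈) (m≤m+n K K)))) ⟩
    #nonDistinct m + ∑[ j ∈ upTo K ] (2 * level j)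
      ≡⟨ cong (#nonDistinct m +_) (∑-*ˡ 2 level (upTo K)) ⟩
    #nonDistinct m + 2 * ∑ level (upTo K) ∎
    where open ≤-Reasoning

  X : ℕ
  X = n ^ m

  n^[m∸i]*n^i≡X : ∀ i → i ≤ m → n ^ (m ∸ i) * n ^ i ≡ X
  n^[m∸i]*n^i≡X i i≤m = trans (sym (^-distribˡ-+-* n (m ∸ i) i)) (cong (n ^_) (m∸n+n≡m i≤m))

  module _ (minDeg : MinDegCond H) (2≤k : 2 ≤ k) (k≤n : k ≤ n) where

    1≤k : 1 ≤ k
    1≤k = ≤-trans (s≤s z≤n) 2≤k

    1≤K : 1 ≤ K
    1≤K = ∸-monoˡ-≤ 1 2≤k

    22*level0≤X : 22 * level 0 ≤ X
    22*level0≤X = begin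
      22 * (n ^ (m ∸ 1) * #badAt 1)   ≡⟨ x∙yz≈y∙xz 22 (n ^ (m ∸ 1)) (#badAt 1) ⟩
      n ^ (m ∸ 1) * (22 * #badAt 1)   ≤⟨ *-monoʳ-≤ (n ^ (m ∸ 1)) (≤-trans (#badAt-≤ minDeg 0 1≤k k≤n) (≤-reflexive (*-identityˡ (n ^ 1)))) ⟩
      n ^ (m ∸ 1) * n ^ 1             ≡⟨ n^[m∸i]*n^i≡X 1 (≤-trans 1≤K (m≤m+n K K)) ⟩
      X                               ∎
      where open ≤-Reasoning

    k*22*level[1+j]≤X : ∀ j → suc (suc j) ≤ K → k * (22 * level (suc j)) ≤ X
    k*22*level[1+j]≤X j i≤K = begin
      k * (22 * (n ^ (m ∸ i) * B))   ≡⟨ regroup k (n ^ (m ∸ i)) B ⟩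
      n ^ (m ∸ i) * (22 * k * B)     ≤⟨ *-monoʳ-≤ (n ^ (m ∸ i)) 22*k*B≤nⁱ ⟩
      n ^ (m ∸ i) * n ^ i            ≡⟨ n^[m∸i]*n^i≡X i (≤-trans i≤K (m≤m+n K K)) ⟩
      X                              ∎
      where
      open ≤-Reasoning
      i : ℕ
      i = suc (suc j)
      B : ℕ
      B = #badAt i
      regroup : ∀ k x b → k * (22 * (x * b)) ≡ x * (22 * k * b)
      regroup = solve-∀
      regroup′ : ∀ kʲ k b → kʲ * (22 * k * b) ≡ 22 * (k * kʲ) * b
      regroup′ = solve-∀
      22*k*B≤nⁱ : 22 * k * B ≤ n ^ i
      22*k*B≤nⁱ = *-cancelˡ-≤ (k ^ suc j) {{m^n≢0 k (suc j) {{>-nonZero 1≤k}}}} (begin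
        k ^ suc j * (22 * k * B)    ≡⟨ regroup′ (k ^ suc j) k B ⟩
        22 * (k * k ^ suc j) * B    ≤⟨ *-monoˡ-≤ B (*-monoʳ-≤ 22 (k^[2+j]≤D^[1+j] k j)) ⟩
        22 * D k ^ suc j * B        ≤⟨ #badAt-≤ minDeg (suc j) (≤-trans i≤K (m∸n≤m k 1)) k≤n ⟩
        k ^ suc j * n ^ i           ∎)

    -- The i = 1 term alone may use X/22, but each of the remaining k - 2 terms uses at most X/(22k).
    22*∑level≤2X : 22 * ∑ level (upTo K) ≤ 2 * X
    22*∑level≤2X = subst (λ l → 22 * ∑ level (upTo l) ≤ 2 * X) (sym K≡1+K′) (begin
      22 * (level 0 + ∑ level (applyUpTo suc K′))        ≡⟨ *-distribˡ-+ 22 (level 0) _ ⟩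
      22 * level 0 + 22 * ∑ level (applyUpTo suc K′)     ≤⟨ +-mono-≤ 22*level0≤X 22*tail≤X ⟩
      X + X                                              ≡⟨ cong (X +_) (sym (+-identityʳ X)) ⟩
      2 * X                                              ∎)
      where
      open ≤-Reasoning
      K′ : ℕ
      K′ = k ∸ 2
      K≡1+K′ : K ≡ suc K′
      K≡1+K′ = cong pred (sym (m+[n∸m]≡n 2≤k))
      22*tail≤X : 22 * ∑ level (applyUpTo suc K′) ≤ X
      22*tail≤X = *-cancelˡ-≤ k {{>-nonZero 1≤k}} (begin
        k * (22 * ∑ level (applyUpTo suc K′))              ≡⟨ cong (k *_) (sym (∑-*ˡ 22 level (applyUpTo suc K′))) ⟩
        k * ∑[ j ∈ applyUpTo suc K′ ] (22 * level j)       ≡⟨ sym (∑-*ˡ k _ (applyUpTo suc K′)) ⟩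
        ∑[ j ∈ applyUpTo suc K′ ] (k * (22 * level j))     ≤⟨ ∑-mono-∈ (applyUpTo suc K′) tail-term ⟩
        ∑[ _ ∈ applyUpTo suc K′ ] X                        ≡⟨ ∑-const X (applyUpTo suc K′) ⟩
        length (applyUpTo suc K′) * X                      ≡⟨ cong (_* X) (length-applyUpTo suc K′) ⟩
        K′ * X                                             ≤⟨ *-monoˡ-≤ X (m∸n≤m k 2) ⟩
        k * X                                              ∎)
        where
        tail-term : ∀ j → j ∈ applyUpTo suc K′ → k * (22 * level j) ≤ X
        tail-term j j∈ with ∈-applyUpTo⁻ suc j∈
        ... | j′ , j′<K′ , refl = k*22*level[1+j]≤X j′ (subst (suc (suc j′) ≤_) (sym K≡1+K′) (s≤s j′<K′))

    11*#nonDistinct≤X : 11 * m * m ≤ n → 11 * #nonDistinct m ≤ X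
    11*#nonDistinct≤X 11m²≤n = *-cancelˡ-≤ n {{>-nonZero (≤-trans 1≤k k≤n)}} (begin
      n * (11 * #nonDistinct m)    ≡⟨ x∙yz≈y∙xz n 11 _ ⟩
      11 * (n * #nonDistinct m)    ≤⟨ *-monoʳ-≤ 11 (#nonDistinct-≤ m) ⟩
      11 * (m * m * X)             ≡⟨ regroup m X ⟩
      11 * m * m * X               ≤⟨ *-monoˡ-≤ X 11m²≤n ⟩
      n * X                        ∎)
      where
      open ≤-Reasoning
      regroup : ∀ m x → 11 * (m * m * x) ≡ 11 * m * m * x
      regroup = solve-∀

    #events-≥ : 11 * m * m ≤ n → 8 * X ≤ 11 * ∑[ xs ∈ tuples m ] 𝟙 (isEvent xs)
    #events-≥ 11m²≤n = +-cancelʳ-≤ (11 * #failures) (8 * X) (11 * #events) (begin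
      8 * X + 11 * #failures
        ≤⟨ +-monoʳ-≤ (8 * X) (*-monoʳ-≤ 11 #failures-≤) ⟩
      8 * X + 11 * (#nonDistinct {n} m + 2 * ∑ level (upTo K))
        ≡⟨ cong (8 * X +_) (trans (*-distribˡ-+ 11 (#nonDistinct {n} m) _) (cong (11 * #nonDistinct {n} m +_) (sym (*-assoc 11 2 (∑ level (upTo K)))))) ⟩
      8 * X + (11 * #nonDistinct {n} m + 22 * ∑ level (upTo K))
        ≤⟨ +-monoʳ-≤ (8 * X) (+-mono-≤ (11*#nonDistinct≤X 11m²≤n) 22*∑level≤2X) ⟩
      8 * X + (X + 2 * X)
        ≡⟨ regroup X ⟩
      11 * X
        ≡⟨ cong (11 *_) (sym #events+#failures≡X) ⟩
      11 * (#events + #failures)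
        ≡⟨ *-distribˡ-+ 11 #events #failures ⟩
      11 * #events + 11 * #failures ∎)
      where
      open ≤-Reasoning
      #events : ℕ
      #events = ∑[ xs ∈ tuples m ] 𝟙 (isEvent xs)
      #failures : ℕ
      #failures = ∑[ xs ∈ tuples m ] 𝟙 (not (isEvent xs))
      #events+#failures≡X : #events + #failures ≡ X
      #events+#failures≡X = begin-equality
        #events + #failures                ≡⟨ sym (∑-+ _ _ (tuples m)) ⟩
        ∑[ xs ∈ tuples m ] (𝟙 (isEvent xs) + 𝟙 (not (isEvent xs)))
                                           ≡⟨ ∑-cong (𝟙-+-𝟙-not ∘ isEvent) (tuples m) ⟩
        ∑[ _ ∈ tuples {n} m ] 1            ≡⟨ ∑-tuples-const m 1 ⟩
        X * 1                              ≡⟨ *-identityʳ X ⟩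
        X                                  ∎
      regroup : ∀ x → 8 * x + (x + 2 * x) ≡ 11 * x
      regroup = solve-∀

2*k∸2≡[k∸1]+[k∸1] : ∀ k → 2 * k ∸ 2 ≡ (k ∸ 1) + (k ∸ 1)
2*k∸2≡[k∸1]+[k∸1] zero    = refl
2*k∸2≡[k∸1]+[k∸1] (suc k) rewrite +-identityʳ k | +-suc k k = refl

eventCount≡∑ : ∀ {k n} (H : KGraph k n) → eventCount H ≡ ∑[ xs ∈ tuples (2 * k ∸ 2) ] 𝟙 (Events.isEvent H xs)
eventCount≡∑ {k} {n} H = trans (length-filterᵇ (event H) (allTuples (2 * k ∸ 2) n)) (∑-allTuples (2 * k ∸ 2) (𝟙 ∘ Events.isEvent H))

lemma1 : ∀ (k : ℕ) → 2 ≤ k →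
    ∃[ n₀ ] ∀ (n : ℕ) → n₀ ≤ n → (H : KGraph k n) → MinDegCond H →
    8 * n ^ (2 * k ∸ 2) ≤ 11 * eventCount H
lemma1 k 2≤k = 44 * (k * k) , bound
  where
  bound : ∀ n → 44 * (k * k) ≤ n → (H : KGraph k n) → MinDegCond H → 8 * n ^ (2 * k ∸ 2) ≤ 11 * eventCount H
  bound n 44k²≤n H minDeg = begin
    8 * n ^ (2 * k ∸ 2)                                   ≡⟨ cong (λ e → 8 * n ^ e) m≡ ⟩
    8 * n ^ m                                             ≤⟨ Events.#events-≥ H minDeg 2≤k k≤n (≤-trans 11m²≤44k² 44k²≤n) ⟩
    11 * ∑[ xs ∈ tuples m ] 𝟙 (Events.isEvent H xs)     ≡⟨ cong (λ e → 11 * ∑[ xs ∈ tuples e ] 𝟙 (Events.isEvent H xs)) (sym m≡) ⟩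
    11 * ∑[ xs ∈ tuples (2 * k ∸ 2) ] 𝟙 (Events.isEvent H xs) ≡⟨ cong (11 *_) (sym (eventCount≡∑ H)) ⟩
    11 * eventCount H                                     ∎
    where
    open ≤-Reasoning
    m : ℕ
    m = (k ∸ 1) + (k ∸ 1)
    m≡ : 2 * k ∸ 2 ≡ m
    m≡ = 2*k∸2≡[k∸1]+[k∸1] k
    k≤n : k ≤ n
    k≤n = ≤-trans (m≤m*n k k {{>-nonZero (≤-trans (s≤s z≤n) 2≤k)}}) (≤-trans (m≤n*m (k * k) 44) 44k²≤n)
    m≤2k : m ≤ k + k
    m≤2k = +-mono-≤ (m∸n≤m k 1) (m∸n≤m k 1)
    11m²≤44k² : 11 * m * m ≤ 44 * (k * k)
    11m²≤44k² = ≤-trans (*-mono-≤ (*-monoʳ-≤ 11 m≤2k) m≤2k) (≤-reflexive (square k))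
      where
      square : ∀ k → 11 * (k + k) * (k + k) ≡ 44 * (k * k)
      square = solve-∀
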